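{- Let $w\in\widetilde{S}_n$ avoid the pattern $3412$ and let $x=x_1\cdots x_k=w_{q+1}\cdots w_{q+k}$ be a factoring subword of $w$. Let $j$, $d$, $J$ and $w'=\Psi(w)$ be as defined in the context. Then $w'\in(\widetilde{S}_n)_J$.
   Context: $\widetilde{S}_n$ is the set of bijections $w:\mathbb{Z}\to\mathbb{Z}$ with $w(i+n)=w(i)+n$ and $\sum_{i=1}^n w(i)=\binom{n+1}{2}$; write $w_i=w(i)$. It is a Coxeter group with generators $S=\{s_0,\dots,s_{n-1}\}$, $s_i$ interchanging $i+kn$ and $i+1+kn$ for all $k$ (indices of generators mod $n$); $(\widetilde{S}_n)_J$ denotes the subgroup generated by $J\subseteq S$. Pattern containment: $w$ contains $p\in S_k$ if there exist integers $i_1<\dots<i_k$ with $w_{i_1},\dots,w_{i_k}$ in the same relative order as $p$. A factoring subword of $w$ is a consecutive subsequence $x=x_1\cdots x_k=w_{q+1}\cdots w_{q+k}$ ($k\ge1$) such that: (1) $x_1>\dots>x_k$; (2) $x_1>w_i$ for all $i\le q$; (3) $x_k<w_i$ for all $i>q+k$; (4) if $x_k>w_i$ for all $i\le q$, then $w_i>x_1$ for all $i>q+k$. (Necessarily $k\le n$.) The pivot index $j$ is the largest $j\in\{1,\dots,k\}$ such that no $w_i$ with $i\le q$ exceeds $x_j$; if this largest value equals $k$, set $j=1$ instead. Define $\Psi(w)=w'$ to be the element of $\widetilde{S}_n$ obtained from $w$ by replacing the block of values $x_1\cdots x_k$ in positions $q+1,\dots,q+k$ by $x_{j+1}\cdots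 x_k\,x_1\cdots x_j$ (and correspondingly in all translates of positions by multiples of $n$, shifted in value by the same multiples of $n$). Let $d=q+k-j$ (so $x_1$ sits in position $d+1$ of $w'$ and $x_k$ in position $d$), and $J=S\setminus\{s_d\}$ with $d$ read mod $n$. -}

module Defs where

open import Data.Nat as ℕ using (ℕ; zero; suc; NonZero; _∸_)
open import Data.Nat.Combinatorics using (_C_)
open import Data.Integer as ℤ using (ℤ; +_; _+_; _-_; _*_; _≤_; _<_; _>_)
open import Data.Integer.DivMod using (_/ℕ_; _%ℕ_)
open import Data.Fin using (Fin; toℕ)
open import Data.List using (List; []; _∷_; map; upTo; sum)
open import Data.List.Relation.Unary.All using (All)
open import Data.Product using (Σ; ∃; _×_; _,_)
open import Data.Bool using (if_then_else_)
open import Relation.Nullary using (¬_)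
open import Relation.Nullary.Decidable using (⌊_⌋)
open import Relation.Binary.PropositionalEquality using (_≡_; _≢_)

sumℤ : List ℤ → ℤ
sumℤ [] = + 0
sumℤ (a ∷ as) = a + sumℤ as

record IsAffPerm (n : ℕ) (w : ℤ → ℤ) : Set where
  field
    injective  : ∀ a b → w a ≡ w b → a ≡ b
    surjective : ∀ y → ∃ λ x → w x ≡ y
    periodic   : ∀ i → w (i + + n) ≡ w i + + n
    window-sum : sumℤ (map (λ i → w (+ suc i)) (upTo n)) ≡ + (suc n C 2)

Contains3412 : (ℤ → ℤ) → Set
Contains3412 w = Σ ℤ λ i₁ → Σ ℤ λ i₂ → Σ ℤ λ i₃ → Σ ℤ λ i₄ →
  i₁ < i₂ × i₂ < i₃ × i₃ < i₄ ×
  w i₃ < w i₄ × w i₄ < w i₁ × w i₁ < w i₂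

Avoids3412 : (ℤ → ℤ) → Set
Avoids3412 w = ¬ Contains3412 w

x : (ℤ → ℤ) → ℤ → ℕ → ℤ
x w q m = w (q + + m)

record IsFactoringSubword (w : ℤ → ℤ) (q : ℤ) (k : ℕ) : Set where
  field
    k≥1  : 1 ℕ.≤ k
    decr : ∀ m → 1 ℕ.≤ m → m ℕ.< k → x w q m > x w q (suc m)
    left : ∀ i → i ≤ q → x w q 1 > w i
    right : ∀ i → i > q + + k → x w q k < w i
    cond4 : (∀ i → i ≤ q → x w q k > w i) → ∀ i → i > q + + k → w i > x w q 1

NoneLeftExceeds : (ℤ → ℤ) → ℤ → ℕ → Set
NoneLeftExceeds w q m = ∀ i → i ≤ q → ¬ (w i > x w q m)

IsLargestPivotCandidate : (ℤ → ℤ) → ℤ → ℕ → ℕ → Set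
IsLargestPivotCandidate w q k j₀ =
  1 ℕ.≤ j₀ × j₀ ℕ.≤ k × NoneLeftExceeds w q j₀ ×
  (∀ m → j₀ ℕ.< m → m ℕ.≤ k → ¬ NoneLeftExceeds w q m)

pivot : ℕ → ℕ → ℕ
pivot j₀ k = if ⌊ j₀ ℕ.≟ k ⌋ then 1 else j₀

-- Ψ(w): in the window q+1..q+n, position q+1+r gets
--   x_{j+1+r}          for r < k-j,
--   x_{1+r-(k-j)}      for k-j ≤ r < k,
--   w(q+1+r)           for k ≤ r < n,
-- extended by w'(i + t n) = w'(i) + t n.
Ψ : (n : ℕ) → .{{NonZero n}} → (ℤ → ℤ) → ℤ → ℕ → ℕ → ℤ → ℤ
Ψ n w q k j i = blockVal (a %ℕ n) + (a /ℕ n) * + n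
  where
  a : ℤ
  a = i - (q + + 1)
  blockVal : ℕ → ℤ
  blockVal r =
    if ⌊ r ℕ.<? (k ∸ j) ⌋ then w (q + + (1 ℕ.+ j ℕ.+ r))
    else if ⌊ r ℕ.<? k ⌋ then w (q + + (1 ℕ.+ r ∸ (k ∸ j)))
    else w (q + + (1 ℕ.+ r))

gen : (n : ℕ) → .{{NonZero n}} → Fin n → ℤ → ℤ
gen n i m =
  if ⌊ (m %ℕ n) ℕ.≟ toℕ i ⌋ then m + + 1
  else if ⌊ (m %ℕ n) ℕ.≟ ((suc (toℕ i)) ℕ.% n) ⌋ then m - + 1
  else m

word : (n : ℕ) → .{{NonZero n}} → List (Fin n) → ℤ → ℤ
word n [] m = m
word n (i ∷ is) m = gen n i (word n is m)

InParabolic : (n : ℕ) → .{{NonZero n}} → (Fin n → Set) → (ℤ → ℤ) → Set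
InParabolic n J w = Σ (List (Fin n)) λ L → All J L × (∀ m → w m ≡ word n L m)

ParabolicJ : (n : ℕ) → .{{NonZero n}} → ℤ → Fin n → Set
ParabolicJ n d i = toℕ i ≢ d %ℕ n

-- Write d = q + k − j and W = {d + 1, …, d + n}. A periodic bijection that maps W onto itself is
-- a product of the adjacent transpositions s_{d+1}, …, s_{d+n−1} of W (bubble sort), none of
-- which is s_d; so it suffices to show ψ = Ψ(w) maps W onto W.
-- ψ only rearranges w on the positions q + 1, …, q + n, so it is periodic and has the window
-- sums of w, i.e. of the identity. Each ψ(d + 1 + c) is w at a "high" position (among x₁ … x_j,
-- or right of the subword) whose translate by −n is a "low" position (left of the subword, or
-- among x_{j+1} … x_k). Avoidance of 3412 and the maximality of j make every low value smaller
-- than every high value, so the n values ψ(W) lie in an interval of length n; being distinct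
-- mod n and having the sum of W, they are exactly W.

module Submission where

open import Defs
open import Data.Bool using (if_then_else_)
open import Data.Empty using (⊥; ⊥-elim)
open import Data.Fin using (Fin; toℕ; fromℕ<)
open import Data.Fin.Properties using (toℕ-fromℕ<)
open import Data.Integer as ℤ using (ℤ; +_; -[1+_]; _+_; _-_; _*_; -_; _≤_; _<_; _>_; 0ℤ)
open import Data.Integer.DivMod using (_/ℕ_; _%ℕ_; a≡a%ℕn+[a/ℕn]*n; n%ℕd<d)
import Data.Integer.Properties as ℤP
open import Data.Integer.Tactic.RingSolver using (solve-∀)
open import Data.List using (List; []; _∷_; map; applyUpTo)
open import Data.List.Relation.Unary.All using (All; []; _∷_)
open import Data.Nat as ℕ using (ℕ; zero; suc; NonZero; _∸_; z≤n; s≤s)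
open import Data.Nat.Combinatorics using (_C_; nCk+nC[k+1]≡[n+1]C[k+1]; nC1≡n)
open import Data.Nat.DivMod using (m<n⇒m%n≡m; n%n≡0)
import Data.Nat.Properties as ℕP
open import Data.Product using (∃; _×_; _,_; proj₁; proj₂)
open import Data.Sum using (_⊎_; inj₁; inj₂)
open import Function using (_∘_)
open import Relation.Binary.PropositionalEquality
open import Relation.Nullary using (¬_; yes; no; Dec)
open import Relation.Nullary.Decidable using (⌊_⌋; isYes≗does; dec-true; dec-false)
open import Algebra.Properties.AbelianGroup ℤP.+-0-abelianGroup using () renaming (∙-cancelˡ to +-cancelˡ-≡)

if-yes : ∀ {P A : Set} (p? : Dec P) {x y : A} → P → (if ⌊ p? ⌋ then x else y) ≡ x
if-yes p? p = cong (if_then _ else _) (trans (isYes≗does p?) (dec-true p? p))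

if-no : ∀ {P A : Set} (p? : Dec P) {x y : A} → ¬ P → (if ⌊ p? ⌋ then x else y) ≡ y
if-no p? ¬p = cong (if_then _ else _) (trans (isYes≗does p?) (dec-false p? ¬p))

ℤ-induction : (P : ℤ → Set) → P 0ℤ → (∀ a → P a → P (a + + 1)) → (∀ a → P (a + + 1) → P a) →
              ∀ a → P a
ℤ-induction P p₀ up down (+ m) = nonNegative m
  where
  nonNegative : ∀ m → P (+ m)
  nonNegative zero    = p₀
  nonNegative (suc m) = subst P (cong +_ (ℕP.+-comm m 1)) (up (+ m) (nonNegative m))
ℤ-induction P p₀ up down -[1+ m ] = negative m
  where
  negative : ∀ m → P -[1+ m ]
  negative zero    = down -[1+ 0 ] p₀
  negative (suc m) = down -[1+ suc m ] (negative m)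

shift-invariant⇒constant : (g : ℤ → ℤ) → (∀ a → g (a + + 1) ≡ g a) → ∀ a b → g a ≡ g b
shift-invariant⇒constant g invariant a b = trans (toZero a) (sym (toZero b))
  where
  toZero : ∀ a → g a ≡ g 0ℤ
  toZero = ℤ-induction _ refl (λ a h → trans (invariant a) h) (λ a h → trans (sym (invariant a)) h)

i≤j+i⇒0≤j : ∀ {i j} → i ≤ j + i → 0ℤ ≤ j
i≤j+i⇒0≤j {i} {j} le = subst₂ _≤_ (ℤP.+-inverseʳ i) (cancel j i) (ℤP.+-monoˡ-≤ (- i) le)
  where
  cancel : ∀ j i → j + i - i ≡ j
  cancel = solve-∀

module Residues (n : ℕ) .{{_ : NonZero n}} where

  N : ℤ
  N = + n

  private
    n≤r : ∀ {r r' m} → + r ≡ + r' + + suc m * N → n ℕ.≤ r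
    n≤r {r} {r'} {m} eq = ℕP.≤-trans (ℕP.m≤m+n n (m ℕ.* n)) (ℕP.≤-trans (ℕP.m≤n+m _ r')
      (ℕP.≤-reflexive (ℤP.+-injective (sym (trans eq (cong (_+_ (+ r')) (sym (ℤP.pos-* (suc m) n))))))))

    multiple-of-N≡0 : ∀ {r r' δ} → r ℕ.< n → r' ℕ.< n → + r ≡ + r' + δ * N → δ ≡ 0ℤ
    multiple-of-N≡0 {δ = + zero}   _   _    _  = refl
    multiple-of-N≡0 {δ = + suc m}  r<n _    eq = ⊥-elim (ℕP.<⇒≱ r<n (n≤r {m = m} eq))
    multiple-of-N≡0 {r} {r'} { -[1+ m ]} _ r'<n eq = ⊥-elim (ℕP.<⇒≱ r'<n (n≤r {m = m} eq'))
      where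
      move : ∀ r' a N → r' ≡ r' + (- a) * N + a * N
      move = solve-∀
      eq' : + r' ≡ + r + + suc m * N
      eq' = trans (move (+ r') (+ suc m) N) (cong (_+ + suc m * N) (sym eq))

  divMod-unique : ∀ {r r'} t t' → r ℕ.< n → r' ℕ.< n → + r + t * N ≡ + r' + t' * N →
                  r ≡ r' × t ≡ t'
  divMod-unique {r} {r'} t t' r<n r'<n eq =
    ℤP.+-injective r≡r' , sym (ℤP.i-j≡0⇒i≡j t' t t'-t≡0)
    where
    move : ∀ r r' t t' N → r + t * N ≡ r' + t' * N → r ≡ r' + (t' - t) * N
    move r r' t t' N eq = trans (e₁ r t N) (trans (cong (_- t * N) eq) (e₂ r' t t' N))
      where
      e₁ : ∀ r t N → r ≡ r + t * N - t * N
      e₁ = solve-∀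
      e₂ : ∀ r' t t' N → r' + t' * N - t * N ≡ r' + (t' - t) * N
      e₂ = solve-∀
    shifted : + r ≡ + r' + (t' - t) * N
    shifted = move (+ r) (+ r') t t' N eq
    t'-t≡0 : t' - t ≡ 0ℤ
    t'-t≡0 = multiple-of-N≡0 r<n r'<n shifted
    r≡r' : + r ≡ + r'
    r≡r' = trans shifted (trans (cong (λ δ → + r' + δ * N) t'-t≡0) (ℤP.+-identityʳ (+ r')))

  %ℕ-/ℕ-unique : ∀ {a r} t → r ℕ.< n → a ≡ + r + t * N → a %ℕ n ≡ r × a /ℕ n ≡ t
  %ℕ-/ℕ-unique {a} t r<n eq = divMod-unique (a /ℕ n) t (n%ℕd<d a n) r<n (trans (sym (a≡a%ℕn+[a/ℕn]*n a n)) eq)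

  %ℕ-≡⇒≡+* : ∀ a b → a %ℕ n ≡ b %ℕ n → ∃ λ t → a ≡ b + t * N
  %ℕ-≡⇒≡+* a b eq = a /ℕ n - b /ℕ n , (begin
    a                                           ≡⟨ a≡a%ℕn+[a/ℕn]*n a n ⟩
    + (a %ℕ n) + a /ℕ n * N                     ≡⟨ cong (λ r → + r + a /ℕ n * N) eq ⟩
    + (b %ℕ n) + a /ℕ n * N                     ≡⟨ regroup (+ (b %ℕ n)) (a /ℕ n) (b /ℕ n) N ⟩
    + (b %ℕ n) + b /ℕ n * N + (a /ℕ n - b /ℕ n) * N ≡⟨ cong (_+ (a /ℕ n - b /ℕ n) * N) (sym (a≡a%ℕn+[a/ℕn]*n b n)) ⟩
    b + (a /ℕ n - b /ℕ n) * N                   ∎)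
    where
    open ≡-Reasoning
    regroup : ∀ r s t N → r + s * N ≡ r + t * N + (s - t) * N
    regroup = solve-∀

  <N⇒≤%ℕ : ∀ {a} → a < N → a ≤ + (a %ℕ n)
  <N⇒≤%ℕ {a} a<N with a /ℕ n | a≡a%ℕn+[a/ℕn]*n a n
  ... | + zero   | eq = ℤP.≤-reflexive (trans eq (ℤP.+-identityʳ _))
  ... | + suc m  | eq = ⊥-elim (ℤP.<⇒≱ a<N (ℤP.≤-trans (ℤ.+≤+ n≤) (ℤP.≤-reflexive (sym eq'))))
    where
    eq' : a ≡ + (a %ℕ n ℕ.+ suc m ℕ.* n)
    eq' = trans eq (cong (_+_ (+ (a %ℕ n))) (sym (ℤP.pos-* (suc m) n)))
    n≤ : n ℕ.≤ a %ℕ n ℕ.+ suc m ℕ.* n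
    n≤ = ℕP.≤-trans (ℕP.m≤m+n n (m ℕ.* n)) (ℕP.m≤n+m (suc m ℕ.* n) (a %ℕ n))
  ... | -[1+ m ] | eq = ℤP.≤-trans (ℤP.≤-reflexive eq)
    (ℤP.≤-trans (ℤP.+-monoʳ-≤ (+ (a %ℕ n)) negative) (ℤP.≤-reflexive (ℤP.+-identityʳ _)))
    where
    negative : -[1+ m ] * N ≤ 0ℤ
    negative = subst (_≤ 0ℤ) (trans (cong -_ (ℤP.pos-* (suc m) n)) (ℤP.neg-distribˡ-* (+ suc m) N))
                     ℤP.neg-≤-pos

∑ : ℕ → (ℕ → ℤ) → ℤ
∑ zero    g = 0ℤ
∑ (suc m) g = g 0 + ∑ m (g ∘ suc)

∑-cong : ∀ m {g h : ℕ → ℤ} → (∀ c → c ℕ.< m → g c ≡ h c) → ∑ m g ≡ ∑ m h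
∑-cong zero    eq = refl
∑-cong (suc m) eq = cong₂ _+_ (eq 0 (s≤s z≤n)) (∑-cong m (λ c c<m → eq (suc c) (s≤s c<m)))

∑-split : ∀ a b (g : ℕ → ℤ) → ∑ (a ℕ.+ b) g ≡ ∑ a g + ∑ b (g ∘ (a ℕ.+_))
∑-split zero    b g = sym (ℤP.+-identityˡ _)
∑-split (suc a) b g = trans (cong (_+_ (g 0)) (∑-split a b (g ∘ suc))) (sym (ℤP.+-assoc (g 0) _ _))

∑-last : ∀ m (g : ℕ → ℤ) → ∑ (suc m) g ≡ ∑ m g + g m
∑-last m g = begin
  ∑ (suc m) g              ≡⟨ cong (λ l → ∑ l g) (ℕP.+-comm 1 m) ⟩
  ∑ (m ℕ.+ 1) g            ≡⟨ ∑-split m 1 g ⟩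
  ∑ m g + (g (m ℕ.+ 0) + 0ℤ) ≡⟨ cong (_+_ (∑ m g)) (trans (ℤP.+-identityʳ _) (cong g (ℕP.+-identityʳ m))) ⟩
  ∑ m g + g m              ∎
  where open ≡-Reasoning

∑-+ : ∀ m (g h : ℕ → ℤ) → ∑ m (λ c → g c + h c) ≡ ∑ m g + ∑ m h
∑-+ zero    g h = refl
∑-+ (suc m) g h = trans (cong (_+_ (g 0 + h 0)) (∑-+ m (g ∘ suc) (h ∘ suc))) (interchange (g 0) (h 0) _ _)
  where
  interchange : ∀ a b c d → a + b + (c + d) ≡ a + c + (b + d)
  interchange = solve-∀

∑-neg : ∀ m (g : ℕ → ℤ) → ∑ m (-_ ∘ g) ≡ - ∑ m g
∑-neg zero    g = refl
∑-neg (suc m) g = trans (cong (_+_ (- g 0)) (∑-neg m (g ∘ suc))) (sym (ℤP.neg-distrib-+ (g 0) _))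

∑-const : ∀ m a → ∑ m (λ _ → a) ≡ + m * a
∑-const zero    a = refl
∑-const (suc m) a = trans (cong (_+_ (a)) (∑-const m a)) (sym (ℤP.suc-* (+ m) a))

∑-mono-≤ : ∀ m {g h : ℕ → ℤ} → (∀ c → c ℕ.< m → g c ≤ h c) → ∑ m g ≤ ∑ m h
∑-mono-≤ zero    le = ℤP.≤-refl
∑-mono-≤ (suc m) le = ℤP.+-mono-≤ (le 0 (s≤s z≤n)) (∑-mono-≤ m (λ c c<m → le (suc c) (s≤s c<m)))

sumℤ-applyUpTo : ∀ m (f : ℕ → ℕ) (h : ℕ → ℤ) → sumℤ (map h (applyUpTo f m)) ≡ ∑ m (h ∘ f)
sumℤ-applyUpTo zero    f h = refl
sumℤ-applyUpTo (suc m) f h = cong (_+_ (h (f 0))) (sumℤ-applyUpTo m (f ∘ suc) h)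

∑-suc≡binomial : ∀ m → ∑ m (+_ ∘ suc) ≡ + (suc m C 2)
∑-suc≡binomial zero    = refl
∑-suc≡binomial (suc m) = begin
  ∑ (suc m) (+_ ∘ suc)          ≡⟨ ∑-last m (+_ ∘ suc) ⟩
  ∑ m (+_ ∘ suc) + + suc m      ≡⟨ cong (_+ + suc m) (∑-suc≡binomial m) ⟩
  + (suc m C 2) + + suc m       ≡⟨ ℤP.+-comm (+ (suc m C 2)) (+ suc m) ⟩
  + (suc m ℕ.+ suc m C 2)       ≡⟨ cong (λ a → + (a ℕ.+ suc m C 2)) (sym (nC1≡n (suc m))) ⟩
  + (suc m C 1 ℕ.+ suc m C 2)   ≡⟨ cong +_ (nCk+nC[k+1]≡[n+1]C[k+1] (suc m) 1) ⟩
  + (suc (suc m) C 2)           ∎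
  where open ≡-Reasoning

∑-id-doubled : ∀ m → ∑ m (+_) + ∑ m (+_) ≡ (+ m - + 1) * + m
∑-id-doubled zero    = refl
∑-id-doubled (suc m) = begin
  ∑ (suc m) (+_) + ∑ (suc m) (+_)       ≡⟨ cong₂ _+_ (∑-last m (+_)) (∑-last m (+_)) ⟩
  ∑ m (+_) + + m + (∑ m (+_) + + m)     ≡⟨ regroup (∑ m (+_)) (+ m) ⟩
  ∑ m (+_) + ∑ m (+_) + + m + + m       ≡⟨ cong (λ s → s + + m + + m) (∑-id-doubled m) ⟩
  (+ m - + 1) * + m + + m + + m     ≡⟨ expand (+ m) ⟩
  (+ suc m - + 1) * + suc m         ∎
  where
  open ≡-Reasoning
  regroup : ∀ s m → s + m + (s + m) ≡ s + s + m + m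
  regroup = solve-∀
  expand : ∀ m → (m - + 1) * m + m + m ≡ (+ 1 + m - + 1) * (+ 1 + m)
  expand = solve-∀

∑-except-at : ∀ m {g h : ℕ → ℤ} c₀ → c₀ ℕ.< m → (∀ c → c ℕ.< m → c ≢ c₀ → g c ≡ h c) →
              ∑ m g + h c₀ ≡ ∑ m h + g c₀
∑-except-at (suc m) {g} {h} zero _ agree = begin
  g 0 + ∑ m (g ∘ suc) + h 0  ≡⟨ cong (λ s → g 0 + s + h 0) (∑-cong m (λ c c<m → agree (suc c) (s≤s c<m) λ ())) ⟩
  g 0 + ∑ m (h ∘ suc) + h 0  ≡⟨ swap (g 0) (∑ m (h ∘ suc)) (h 0) ⟩
  h 0 + ∑ m (h ∘ suc) + g 0  ∎
  where
  open ≡-Reasoning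
  swap : ∀ a s b → a + s + b ≡ b + s + a
  swap = solve-∀
∑-except-at (suc m) {g} {h} (suc c₀) (s≤s c₀<m) agree = begin
  g 0 + ∑ m (g ∘ suc) + h (suc c₀)    ≡⟨ ℤP.+-assoc (g 0) _ _ ⟩
  g 0 + (∑ m (g ∘ suc) + h (suc c₀))  ≡⟨ cong₂ _+_ (agree 0 (s≤s z≤n) λ ()) rest ⟩
  h 0 + (∑ m (h ∘ suc) + g (suc c₀))  ≡⟨ ℤP.+-assoc (h 0) _ _ ⟨
  h 0 + ∑ m (h ∘ suc) + g (suc c₀)    ∎
  where
  open ≡-Reasoning
  rest = ∑-except-at m c₀ c₀<m (λ c c<m c≢c₀ → agree (suc c) (s≤s c<m) (c≢c₀ ∘ ℕP.suc-injective))

findBelow : ∀ m (u : ℕ → ℕ) v → (∃ λ c → c ℕ.< m × u c ≡ v) ⊎ (∀ c → c ℕ.< m → u c ≢ v)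
findBelow zero    u v = inj₂ λ _ ()
findBelow (suc m) u v with u 0 ℕ.≟ v | findBelow m (u ∘ suc) v
... | yes hit  | _                   = inj₁ (0 , s≤s z≤n , hit)
... | no _     | inj₁ (c , c<m , hit) = inj₁ (suc c , s≤s c<m , hit)
... | no miss₀ | inj₂ miss          = inj₂ λ { zero _ → miss₀ ; (suc c) (s≤s c<m) → miss c c<m }

record PermutationBelow (m : ℕ) (u : ℕ → ℕ) : Set where
  field
    bounded   : ∀ c → c ℕ.< m → u c ℕ.< m
    injective : ∀ c c' → c ℕ.< m → c' ℕ.< m → u c ≡ u c' → c ≡ c'

_[_≔_] : (ℕ → ℕ) → ℕ → ℕ → ℕ → ℕ
(u [ c₀ ≔ v ]) c = if ⌊ c ℕ.≟ c₀ ⌋ then v else u c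

private
  <-suc-≢⇒< : ∀ {a m} → a ℕ.< suc m → a ≢ m → a ℕ.< m
  <-suc-≢⇒< a<1+m a≢m = ℕP.≤∧≢⇒< (ℕP.≤-pred a<1+m) a≢m

  restrict-unhit : ∀ {m u} → PermutationBelow (suc m) u → (∀ c → c ℕ.< m → u c ≢ m) →
                   PermutationBelow m u × ∑ (suc m) (+_ ∘ u) ≤ ∑ m (+_ ∘ u) + + m
  restrict-unhit {m} {u} p miss = record { bounded = bounded′ ; injective = injective′ } , (begin
    ∑ (suc m) (+_ ∘ u)       ≡⟨ ∑-last m (+_ ∘ u) ⟩
    ∑ m (+_ ∘ u) + + u m      ≤⟨ ℤP.+-monoʳ-≤ (∑ m (+_ ∘ u)) (ℤ.+≤+ (ℕP.≤-pred (bounded m ℕP.≤-refl))) ⟩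
    ∑ m (+_ ∘ u) + + m        ∎)
    where
    open PermutationBelow p
    open ℤP.≤-Reasoning
    bounded′ : ∀ c → c ℕ.< m → u c ℕ.< m
    bounded′ c c<m = <-suc-≢⇒< (bounded c (ℕP.m<n⇒m<1+n c<m)) (miss c c<m)
    injective′ : ∀ c c' → c ℕ.< m → c' ℕ.< m → u c ≡ u c' → c ≡ c'
    injective′ c c' c<m c'<m = injective c c' (ℕP.m<n⇒m<1+n c<m) (ℕP.m<n⇒m<1+n c'<m)

  redirect-hit : ∀ {m u c₀} → PermutationBelow (suc m) u → c₀ ℕ.< m → u c₀ ≡ m →
                 PermutationBelow m (u [ c₀ ≔ u m ])
  redirect-hit {m} {u} {c₀} p c₀<m uc₀≡m = record { bounded = bounded′ ; injective = injective′ }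
    where
    open PermutationBelow p
    ↑ : ∀ {c} → c ℕ.< m → c ℕ.< suc m
    ↑ = ℕP.m<n⇒m<1+n
    um≢m : u m ≢ m
    um≢m um≡m = ℕP.<-irrefl (sym (injective m c₀ ℕP.≤-refl (↑ c₀<m) (trans um≡m (sym uc₀≡m)))) c₀<m
    value-at : ∀ c → (c ≡ c₀ × (u [ c₀ ≔ u m ]) c ≡ u m) ⊎ (c ≢ c₀ × (u [ c₀ ≔ u m ]) c ≡ u c)
    value-at c with c ℕ.≟ c₀
    ... | yes c≡c₀ = inj₁ (c≡c₀ , refl)
    ... | no c≢c₀  = inj₂ (c≢c₀ , refl)
    bounded′ : ∀ c → c ℕ.< m → (u [ c₀ ≔ u m ]) c ℕ.< m
    bounded′ c c<m with value-at c
    ... | inj₁ (_ , eq) = subst (ℕ._< m) (sym eq) (<-suc-≢⇒< (bounded m ℕP.≤-refl) um≢m)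
    ... | inj₂ (c≢c₀ , eq) = subst (ℕ._< m) (sym eq) (<-suc-≢⇒< (bounded c (↑ c<m))
                               (λ uc≡m → c≢c₀ (injective c c₀ (↑ c<m) (↑ c₀<m) (trans uc≡m (sym uc₀≡m)))))
    top≢ : ∀ {c c'} → c' ℕ.< m → (u [ c₀ ≔ u m ]) c ≡ u m → (u [ c₀ ≔ u m ]) c ≡ u c' → ⊥
    top≢ {c' = c'} c'<m e e' = ℕP.<-irrefl (sym (injective m c' ℕP.≤-refl (↑ c'<m) (trans (sym e) e'))) c'<m
    injective′ : ∀ c c' → c ℕ.< m → c' ℕ.< m → (u [ c₀ ≔ u m ]) c ≡ (u [ c₀ ≔ u m ]) c' → c ≡ c'
    injective′ c c' c<m c'<m eq with value-at c | value-at c'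
    ... | inj₁ (c≡c₀ , _) | inj₁ (c'≡c₀ , _) = trans c≡c₀ (sym c'≡c₀)
    ... | inj₁ (_ , e)    | inj₂ (_ , e')    = ⊥-elim (top≢ c'<m e (trans eq e'))
    ... | inj₂ (_ , e)    | inj₁ (_ , e')    = ⊥-elim (top≢ c<m e' (trans (sym eq) e))
    ... | inj₂ (_ , e)    | inj₂ (_ , e')    = injective c c' (↑ c<m) (↑ c'<m) (trans (sym e) (trans eq e'))

  ∑-redirect : ∀ {m u c₀} → c₀ ℕ.< m → u c₀ ≡ m → ∑ (suc m) (+_ ∘ u) ≡ ∑ m (+_ ∘ (u [ c₀ ≔ u m ])) + + m
  ∑-redirect {m} {u} {c₀} c₀<m uc₀≡m = begin
    ∑ (suc m) (+_ ∘ u)                       ≡⟨ ∑-last m (+_ ∘ u) ⟩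
    ∑ m (+_ ∘ u) + + u m                     ≡⟨ cong (λ v → ∑ m (+_ ∘ u) + + v) (if-yes (c₀ ℕ.≟ c₀) refl) ⟨
    ∑ m (+_ ∘ u) + + (u [ c₀ ≔ u m ]) c₀     ≡⟨ ∑-except-at m c₀ c₀<m agree ⟨
    ∑ m (+_ ∘ (u [ c₀ ≔ u m ])) + + u c₀     ≡⟨ cong (λ v → ∑ m (+_ ∘ (u [ c₀ ≔ u m ])) + + v) uc₀≡m ⟩
    ∑ m (+_ ∘ (u [ c₀ ≔ u m ])) + + m        ∎
    where
    open ≡-Reasoning
    agree : ∀ c → c ℕ.< m → c ≢ c₀ → + (u [ c₀ ≔ u m ]) c ≡ + u c
    agree c _ c≢c₀ = cong +_ (if-no (c ℕ.≟ c₀) c≢c₀)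

  -- If some c₀ < m is sent to m, send it to u m instead.
  dropTop : ∀ {m u} → PermutationBelow (suc m) u →
            ∃ λ u' → PermutationBelow m u' × ∑ (suc m) (+_ ∘ u) ≤ ∑ m (+_ ∘ u') + + m
  dropTop {m} {u} p with findBelow m u m
  ... | inj₂ miss                = u , restrict-unhit p miss
  ... | inj₁ (c₀ , c₀<m , uc₀≡m) = u [ c₀ ≔ u m ] , redirect-hit p c₀<m uc₀≡m , ℤP.≤-reflexive (∑-redirect c₀<m uc₀≡m)

∑-permutation≤ : ∀ m {u} → PermutationBelow m u → ∑ m (+_ ∘ u) ≤ ∑ m (+_)
∑-permutation≤ zero    _ = ℤP.≤-refl
∑-permutation≤ (suc m) {u} p with dropTop p
... | u' , p' , dropped = begin
  ∑ (suc m) (+_ ∘ u)    ≤⟨ dropped ⟩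
  ∑ m (+_ ∘ u') + + m   ≤⟨ ℤP.+-monoˡ-≤ (+ m) (∑-permutation≤ m p') ⟩
  ∑ m (+_) + + m        ≡⟨ ∑-last m (+_) ⟨
  ∑ (suc m) (+_)        ∎
  where open ℤP.≤-Reasoning

module ResidueWindow (n : ℕ) .{{_ : NonZero n}} where
  open Residues n

  private instance
    N-positive : ℤ.Positive N
    N-positive = ℤ.positive (ℤ.+<+ (ℕ.>-nonZero⁻¹ n))

  record IsResidueWindow (z : ℕ → ℤ) : Set where
    field
      spread   : ∀ c c' → c ℕ.< n → c' ℕ.< n → z c < z c' + N
      distinct : ∀ c c' t → c ℕ.< n → c' ℕ.< n → z c ≡ z c' + t * N → c ≡ c'
      total    : ∑ n z ≡ ∑ n (+_)

  -- z c ≤ z c₀ + ((z c - z c₀) mod n), and these residues are a permutation of [0, n).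
  nonNegative : ∀ {z} → IsResidueWindow z → ∀ c₀ → c₀ ℕ.< n → 0ℤ ≤ z c₀
  nonNegative {z} W c₀ c₀<n = ℤP.*-cancelʳ-≤-pos 0ℤ z₀ N (i≤j+i⇒0≤j bound)
    where
    open IsResidueWindow W
    z₀ = z c₀
    u : ℕ → ℕ
    u c = (z c - z₀) %ℕ n
    u-injective : ∀ c c' → c ℕ.< n → c' ℕ.< n → u c ≡ u c' → c ≡ c'
    u-injective c c' c<n c'<n eq with %ℕ-≡⇒≡+* (z c - z₀) (z c' - z₀) eq
    ... | t , e = distinct c c' t c<n c'<n (unshift (z c) (z c') z₀ t N e)
      where
      unshift : ∀ x y a t N → x - a ≡ y - a + t * N → x ≡ y + t * N
      unshift x y a t N e = trans (e₁ x a) (trans (cong (_+ a) e) (e₂ y a t N))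
        where
        e₁ : ∀ x a → x ≡ x - a + a
        e₁ = solve-∀
        e₂ : ∀ y a t N → y - a + t * N + a ≡ y + t * N
        e₂ = solve-∀
    u-permutation : PermutationBelow n u
    u-permutation = record { bounded = λ c _ → n%ℕd<d (z c - z₀) n ; injective = u-injective }
    z≤z₀+u : ∀ c → c ℕ.< n → z c ≤ z₀ + + u c
    z≤z₀+u c c<n = subst₂ _≤_ (e (z c) z₀) refl (ℤP.+-monoʳ-≤ z₀ (<N⇒≤%ℕ difference<N))
      where
      e : ∀ x a → a + (x - a) ≡ x
      e = solve-∀
      difference<N : z c - z₀ < N
      difference<N = subst₂ _<_ refl (e′ z₀ N) (ℤP.+-monoˡ-< (- z₀) (spread c c₀ c<n c₀<n))
        where
        e′ : ∀ a N → a + N - a ≡ N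
        e′ = solve-∀
    bound : ∑ n (+_) ≤ z₀ * N + ∑ n (+_)
    bound = begin
      ∑ n (+_)                           ≡⟨ total ⟨
      ∑ n z                              ≤⟨ ∑-mono-≤ n z≤z₀+u ⟩
      ∑ n (λ c → z₀ + + u c)             ≡⟨ ∑-+ n (λ _ → z₀) (+_ ∘ u) ⟩
      ∑ n (λ _ → z₀) + ∑ n (+_ ∘ u)      ≡⟨ cong (_+ ∑ n (+_ ∘ u)) (trans (∑-const n z₀) (ℤP.*-comm N z₀)) ⟩
      z₀ * N + ∑ n (+_ ∘ u)              ≤⟨ ℤP.+-monoʳ-≤ (z₀ * N) (∑-permutation≤ n u-permutation) ⟩
      z₀ * N + ∑ n (+_)                  ∎
      where open ℤP.≤-Reasoning

  reflect : (ℕ → ℤ) → ℕ → ℤ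
  reflect z c = N - + 1 - z c

  reflect-isResidueWindow : ∀ {z} → IsResidueWindow z → IsResidueWindow (reflect z)
  reflect-isResidueWindow {z} W = record
    { spread   = λ c c' c<n c'<n → flip-< (spread c' c c'<n c<n)
    ; distinct = λ c c' t c<n c'<n e → distinct c c' (- t) c<n c'<n (flip-≡ (z c) (z c') t N e)
    ; total    = total′
    }
    where
    open IsResidueWindow W
    K = N - + 1
    flip-< : ∀ {a b} → b < a + N → K - a < K - b + N
    flip-< {a} {b} b<a+N = subst₂ _<_ (e₁ K a N) refl (ℤP.+-monoˡ-< N (ℤP.+-monoʳ-< K (ℤP.neg-mono-< b<a+N)))
      where
      e₁ : ∀ K a N → K + - (a + N) + N ≡ K - a
      e₁ = solve-∀
    flip-≡ : ∀ x y t N → K - x ≡ K - y + t * N → x ≡ y + (- t) * N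
    flip-≡ x y t N e = trans (e₁ K x) (trans (cong (_-_ K) e) (e₂ K y t N))
      where
      e₁ : ∀ K x → x ≡ K - (K - x)
      e₁ = solve-∀
      e₂ : ∀ K y t N → K - (K - y + t * N) ≡ y + (- t) * N
      e₂ = solve-∀
    total′ : ∑ n (reflect z) ≡ ∑ n (+_)
    total′ = begin
      ∑ n (λ c → K - z c)                ≡⟨ ∑-+ n (λ _ → K) (-_ ∘ z) ⟩
      ∑ n (λ _ → K) + ∑ n (-_ ∘ z)       ≡⟨ cong₂ _+_ (∑-const n K) (trans (∑-neg n z) (cong -_ total)) ⟩
      N * K - ∑ n (+_)                   ≡⟨ cong (_- ∑ n (+_)) (trans (ℤP.*-comm N K) (sym (∑-id-doubled n))) ⟩
      ∑ n (+_) + ∑ n (+_) - ∑ n (+_)     ≡⟨ e (∑ n (+_)) ⟩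
      ∑ n (+_)                           ∎
      where
      open ≡-Reasoning
      e : ∀ s → s + s - s ≡ s
      e = solve-∀

  bounds : ∀ {z} → IsResidueWindow z → ∀ c → c ℕ.< n → 0ℤ ≤ z c × z c < N
  bounds {z} W c c<n = nonNegative W c c<n , ℤP.i≤pred[j]⇒i<j (subst (z c ≤_) (ℤP.+-comm N (- + 1)) z≤K)
    where
    z≤K : z c ≤ N - + 1
    z≤K = ℤP.0≤i-j⇒j≤i (nonNegative (reflect-isResidueWindow W) c c<n)

  +∣∣≡ : ∀ {z} → IsResidueWindow z → ∀ c → c ℕ.< n → + ℤ.∣ z c ∣ ≡ z c
  +∣∣≡ W c c<n = ℤP.0≤i⇒+∣i∣≡i (proj₁ (bounds W c c<n))

  ∣∣-permutationBelow : ∀ {z} → IsResidueWindow z → PermutationBelow n (ℤ.∣_∣ ∘ z)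
  ∣∣-permutationBelow {z} W = record
    { bounded   = λ c c<n → ℤP.drop‿+<+ (subst (_< N) (sym (+∣∣≡ W c c<n)) (proj₂ (bounds W c c<n)))
    ; injective = λ c c' c<n c'<n eq → distinct c c' 0ℤ c<n c'<n
        (trans (sym (+∣∣≡ W c c<n)) (trans (cong +_ eq) (trans (+∣∣≡ W c' c'<n) (sym (ℤP.+-identityʳ (z c'))))))
    }
    where open IsResidueWindow W

module Periodicity (n : ℕ) .{{_ : NonZero n}} where
  open Residues n

  Periodic : (ℤ → ℤ) → Set
  Periodic f = ∀ i → f (i + N) ≡ f i + N

  periodic-backward : ∀ f → Periodic f → ∀ i → f (i - N) ≡ f i - N
  periodic-backward f periodic i = begin
    f (i - N)             ≡⟨ e₁ (f (i - N)) N ⟩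
    f (i - N) + N - N     ≡⟨ cong (_- N) (periodic (i - N)) ⟨
    f (i - N + N) - N     ≡⟨ cong (λ j → f j - N) (e₂ i N) ⟩
    f i - N               ∎
    where
    open ≡-Reasoning
    e₁ : ∀ x N → x ≡ x + N - N
    e₁ = solve-∀
    e₂ : ∀ i N → i - N + N ≡ i
    e₂ = solve-∀

  periodic-+* : ∀ f → Periodic f → ∀ t a → f (a + t * N) ≡ f a + t * N
  periodic-+* f periodic = ℤ-induction (λ t → ∀ a → f (a + t * N) ≡ f a + t * N) base up down
    where
    open ≡-Reasoning
    base : ∀ a → f (a + 0ℤ * N) ≡ f a + 0ℤ * N
    base a = trans (cong f (ℤP.+-identityʳ a)) (sym (ℤP.+-identityʳ (f a)))
    up : ∀ t → (∀ a → f (a + t * N) ≡ f a + t * N) → ∀ a → f (a + (t + + 1) * N) ≡ f a + (t + + 1) * N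
    up t ih a = begin
      f (a + (t + + 1) * N)  ≡⟨ cong f (e a t N) ⟩
      f (a + t * N + N)      ≡⟨ periodic (a + t * N) ⟩
      f (a + t * N) + N      ≡⟨ cong (_+ N) (ih a) ⟩
      f a + t * N + N        ≡⟨ e (f a) t N ⟨
      f a + (t + + 1) * N    ∎
      where
      e : ∀ a t N → a + (t + + 1) * N ≡ a + t * N + N
      e = solve-∀
    down : ∀ t → (∀ a → f (a + (t + + 1) * N) ≡ f a + (t + + 1) * N) → ∀ a → f (a + t * N) ≡ f a + t * N
    down t ih a = begin
      f (a + t * N)                ≡⟨ cong f (e a t N) ⟩
      f (a + (t + + 1) * N - N)    ≡⟨ periodic-backward f periodic _ ⟩
      f (a + (t + + 1) * N) - N    ≡⟨ cong (_- N) (ih a) ⟩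
      f a + (t + + 1) * N - N      ≡⟨ e (f a) t N ⟨
      f a + t * N                  ∎
      where
      e : ∀ a t N → a + t * N ≡ a + (t + + 1) * N - N
      e = solve-∀

  windowSum : (ℤ → ℤ) → ℤ → ℤ
  windowSum f a = ∑ n (λ c → f (a + + c))

  windowSum-step : ∀ f → Periodic f → ∀ a → windowSum f (a + + 1) ≡ windowSum f a + N
  windowSum-step f periodic a = +-cancelˡ-≡ (f a) _ _ (begin
    f a + windowSum f (a + + 1)            ≡⟨ cong₂ _+_ (cong f (ℤP.+-identityʳ a))
                                                        (∑-cong n (λ c _ → cong f (sym (ℤP.+-assoc a (+ 1) (+ c))))) ⟨
    ∑ (suc n) (λ c → f (a + + c))          ≡⟨ ∑-last n (λ c → f (a + + c)) ⟩
    windowSum f a + f (a + N)              ≡⟨ cong (_+_ (windowSum f a)) (periodic a) ⟩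
    windowSum f a + (f a + N)              ≡⟨ e (windowSum f a) (f a) N ⟩
    f a + (windowSum f a + N)              ∎)
    where
    open ≡-Reasoning
    e : ∀ s x N → s + (x + N) ≡ x + (s + N)
    e = solve-∀

  windowExcess : (ℤ → ℤ) → ℤ → ℤ
  windowExcess f a = windowSum f a - windowSum (λ i → i) a

  windowExcess-invariant : ∀ f → Periodic f → ∀ a b → windowExcess f a ≡ windowExcess f b
  windowExcess-invariant f periodic = shift-invariant⇒constant (windowExcess f) step
    where
    e : ∀ x y N → x + N - (y + N) ≡ x - y
    e = solve-∀
    step : ∀ a → windowExcess f (a + + 1) ≡ windowExcess f a
    step a = trans (cong₂ _-_ (windowSum-step f periodic a) (windowSum-step (λ i → i) (λ _ → refl) a)) (e (windowSum f a) (windowSum (λ i → i) a) N)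

swap : ℕ → ℕ → ℕ
swap a x = if ⌊ x ℕ.≟ a ⌋ then suc a else if ⌊ x ℕ.≟ suc a ⌋ then a else x

data SwapView (a x : ℕ) : ℕ → Set where
  at-a      : x ≡ a → SwapView a x (suc a)
  at-suc    : x ≡ suc a → SwapView a x a
  elsewhere : x ≢ a → x ≢ suc a → SwapView a x x

swap-view : ∀ a x → SwapView a x (swap a x)
swap-view a x with x ℕ.≟ a
... | yes x≡a = at-a x≡a
... | no x≢a with x ℕ.≟ suc a
...   | yes x≡1+a = at-suc x≡1+a
...   | no x≢1+a  = elsewhere x≢a x≢1+a

swap-involutive : ∀ a x → swap a (swap a x) ≡ x
swap-involutive a x with swap a x | swap-view a x
... | _ | at-a refl with swap a (suc a) | swap-view a (suc a)
...   | _ | at-a 1+a≡a     = ⊥-elim (ℕP.1+n≢n 1+a≡a)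
...   | _ | at-suc _       = refl
...   | _ | elsewhere _ ne = ⊥-elim (ne refl)
swap-involutive a x | _ | at-suc refl with swap a a | swap-view a a
...   | _ | at-a _         = refl
...   | _ | at-suc a≡1+a   = ⊥-elim (ℕP.1+n≢n (sym a≡1+a))
...   | _ | elsewhere ne _ = ⊥-elim (ne refl)
swap-involutive a x | _ | elsewhere x≢a x≢1+a with swap a x | swap-view a x
...   | _ | at-a x≡a       = ⊥-elim (x≢a x≡a)
...   | _ | at-suc x≡1+a   = ⊥-elim (x≢1+a x≡1+a)
...   | _ | elsewhere _ _  = refl

swap-injective : ∀ a {x y} → swap a x ≡ swap a y → x ≡ y
swap-injective a {x} {y} eq = trans (sym (swap-involutive a x)) (trans (cong (swap a) eq) (swap-involutive a y))

swap-bounded : ∀ a {x m} → x ℕ.< m → suc a ℕ.< m → swap a x ℕ.< m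
swap-bounded a {x} x<m 1+a<m with swap a x | swap-view a x
... | _ | at-a _        = 1+a<m
... | _ | at-suc _      = ℕP.<-trans (ℕP.n<1+n a) 1+a<m
... | _ | elsewhere _ _ = x<m

module Generators (n : ℕ) .{{_ : NonZero n}} where
  open Residues n
  open Periodicity n

  %ℕ-+N : ∀ m → (m + N) %ℕ n ≡ m %ℕ n
  %ℕ-+N m = proj₁ (%ℕ-/ℕ-unique (m /ℕ n + + 1) (n%ℕd<d m n)
              (trans (cong (_+ N) (a≡a%ℕn+[a/ℕn]*n m n)) (e (+ (m %ℕ n)) (m /ℕ n) N)))
    where
    e : ∀ r t N → r + t * N + N ≡ r + (t + + 1) * N
    e = solve-∀

  suc-%ℕ : ∀ x → suc (x %ℕ n) ℕ.% n ≡ (x + + 1) %ℕ n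
  suc-%ℕ x with ℕP.m≤n⇒m<n∨m≡n (n%ℕd<d x n)
  ... | inj₁ 1+r<n = trans (m<n⇒m%n≡m 1+r<n) (sym (proj₁ (%ℕ-/ℕ-unique (x /ℕ n) 1+r<n (begin
    x + + 1                                ≡⟨ cong (_+ + 1) (a≡a%ℕn+[a/ℕn]*n x n) ⟩
    + (x %ℕ n) + x /ℕ n * N + + 1          ≡⟨ e (+ (x %ℕ n)) (x /ℕ n) N ⟩
    + suc (x %ℕ n) + x /ℕ n * N            ∎))))
    where
    open ≡-Reasoning
    e : ∀ r t N → r + t * N + + 1 ≡ + 1 + r + t * N
    e = solve-∀
  ... | inj₂ 1+r≡n = trans (cong (ℕ._% n) 1+r≡n) (trans (n%n≡0 n) (sym (proj₁ (%ℕ-/ℕ-unique (x /ℕ n + + 1) (ℕ.>-nonZero⁻¹ n) (begin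
    x + + 1                                ≡⟨ cong (_+ + 1) (a≡a%ℕn+[a/ℕn]*n x n) ⟩
    + (x %ℕ n) + x /ℕ n * N + + 1          ≡⟨ e (+ (x %ℕ n)) (x /ℕ n) N ⟩
    + suc (x %ℕ n) + x /ℕ n * N            ≡⟨ cong (λ r → + r + x /ℕ n * N) 1+r≡n ⟩
    N + x /ℕ n * N                         ≡⟨ e′ (x /ℕ n) N ⟩
    + 0 + (x /ℕ n + + 1) * N               ∎)))))
    where
    open ≡-Reasoning
    e : ∀ r t N → r + t * N + + 1 ≡ + 1 + r + t * N
    e = solve-∀
    e′ : ∀ t N → N + t * N ≡ + 0 + (t + + 1) * N
    e′ = solve-∀

  +-%ℕ-injective : ∀ b {c c'} → c ℕ.< n → c' ℕ.< n → (b + + c) %ℕ n ≡ (b + + c') %ℕ n → c ≡ c'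
  +-%ℕ-injective b {c} {c'} c<n c'<n eq with %ℕ-≡⇒≡+* (b + + c) (b + + c') eq
  ... | t , shifted = proj₁ (divMod-unique 0ℤ t c<n c'<n (trans (ℤP.+-identityʳ (+ c)) (cancel b (+ c) (+ c') t N shifted)))
    where
    cancel : ∀ b c c' t N → b + c ≡ b + c' + t * N → c ≡ c' + t * N
    cancel b c c' t N eq = trans (e₁ b c) (trans (cong (_- b) eq) (e₂ b c' t N))
      where
      e₁ : ∀ b c → c ≡ b + c - b
      e₁ = solve-∀
      e₂ : ∀ b c' t N → b + c' + t * N - b ≡ c' + t * N
      e₂ = solve-∀

  gen-periodic : ∀ i → Periodic (gen n i)
  gen-periodic i m rewrite %ℕ-+N m with m %ℕ n ℕ.≟ toℕ i
  ... | yes _ = e₁ m N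
    where
    e₁ : ∀ m N → m + N + + 1 ≡ m + + 1 + N
    e₁ = solve-∀
  ... | no _ with m %ℕ n ℕ.≟ suc (toℕ i) ℕ.% n
  ...   | yes _ = e₂ m N
    where
    e₂ : ∀ m N → m + N - + 1 ≡ m - + 1 + N
    e₂ = solve-∀
  ...   | no _ = refl

  word-periodic : ∀ L → Periodic (word n L)
  word-periodic []      m = refl
  word-periodic (i ∷ L) m = trans (cong (gen n i) (word-periodic L m)) (gen-periodic i (word n L m))

  gen-here : ∀ i m → m %ℕ n ≡ toℕ i → gen n i m ≡ m + + 1
  gen-here i m here with m %ℕ n ℕ.≟ toℕ i
  ... | yes _   = refl
  ... | no ¬here = ⊥-elim (¬here here)

  gen-next : ∀ i m → m %ℕ n ≢ toℕ i → m %ℕ n ≡ suc (toℕ i) ℕ.% n → gen n i m ≡ m - + 1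
  gen-next i m ¬here next with m %ℕ n ℕ.≟ toℕ i
  ... | yes here = ⊥-elim (¬here here)
  ... | no _ with m %ℕ n ℕ.≟ suc (toℕ i) ℕ.% n
  ...   | yes _    = refl
  ...   | no ¬next = ⊥-elim (¬next next)

  gen-away : ∀ i m → m %ℕ n ≢ toℕ i → m %ℕ n ≢ suc (toℕ i) ℕ.% n → gen n i m ≡ m
  gen-away i m ¬here ¬next with m %ℕ n ℕ.≟ toℕ i
  ... | yes here = ⊥-elim (¬here here)
  ... | no _ with m %ℕ n ℕ.≟ suc (toℕ i) ℕ.% n
  ...   | yes next = ⊥-elim (¬next next)
  ...   | no _     = refl

  module Window (e : ℤ) where

    pos : ℕ → ℤ
    pos c = e + + suc c

    pos-assoc : ∀ c → pos c ≡ e + + 1 + + c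
    pos-assoc c = sym (ℤP.+-assoc e (+ 1) (+ c))

    pos-%ℕ-injective : ∀ {c c'} → c ℕ.< n → c' ℕ.< n → pos c %ℕ n ≡ pos c' %ℕ n → c ≡ c'
    pos-%ℕ-injective {c} {c'} c<n c'<n eq =
      +-%ℕ-injective (e + + 1) c<n c'<n (subst₂ (λ x y → x %ℕ n ≡ y %ℕ n) (pos-assoc c) (pos-assoc c') eq)

    pos-suc : ∀ c → pos c + + 1 ≡ pos (suc c)
    pos-suc c = trans (ℤP.+-assoc e (+ suc c) (+ 1)) (cong (λ m → e + + m) (ℕP.+-comm (suc c) 1))

    -- s_{e+1+a} (index read mod n), which exchanges pos a and pos (suc a)
    letter : ℕ → Fin n
    letter a = fromℕ< (n%ℕd<d (pos a) n)

    toℕ-letter : ∀ a → toℕ (letter a) ≡ pos a %ℕ n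
    toℕ-letter a = toℕ-fromℕ< (n%ℕd<d (pos a) n)

    suc-toℕ-letter : ∀ a → suc (toℕ (letter a)) ℕ.% n ≡ pos (suc a) %ℕ n
    suc-toℕ-letter a = trans (cong (λ r → suc r ℕ.% n) (toℕ-letter a)) (trans (suc-%ℕ (pos a)) (cong (_%ℕ n) (pos-suc a)))

    letter-allowed : ∀ a → suc a ℕ.< n → ParabolicJ n e (letter a)
    letter-allowed a 1+a<n eq with +-%ℕ-injective e 1+a<n (ℕP.<-trans (s≤s z≤n) 1+a<n)
                                     (trans (sym (toℕ-letter a)) (trans eq (cong (_%ℕ n) (sym (ℤP.+-identityʳ e)))))
    ... | ()

    gen-letter : ∀ a x → suc a ℕ.< n → x ℕ.< n → gen n (letter a) (pos x) ≡ pos (swap a x)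
    gen-letter a x 1+a<n x<n with swap a x | swap-view a x
    ... | _ | at-a refl = trans (gen-here (letter a) (pos a) (sym (toℕ-letter a))) (pos-suc a)
    ... | _ | at-suc refl = begin
      gen n (letter a) (pos (suc a))  ≡⟨ gen-next (letter a) (pos (suc a)) ¬here next ⟩
      pos (suc a) - + 1               ≡⟨ cong (_- + 1) (pos-suc a) ⟨
      pos a + + 1 - + 1               ≡⟨ e′ (pos a) ⟩
      pos a                           ∎
      where
      open ≡-Reasoning
      a<n = ℕP.<-trans (ℕP.n<1+n a) 1+a<n
      ¬here : pos (suc a) %ℕ n ≢ toℕ (letter a)
      ¬here eq = ℕP.1+n≢n (pos-%ℕ-injective 1+a<n a<n (trans eq (toℕ-letter a)))
      next : pos (suc a) %ℕ n ≡ suc (toℕ (letter a)) ℕ.% n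
      next = sym (suc-toℕ-letter a)
      e′ : ∀ x → x + + 1 - + 1 ≡ x
      e′ = solve-∀
    ... | _ | elsewhere x≢a x≢1+a = gen-away (letter a) (pos x) ¬here ¬next
      where
      a<n = ℕP.<-trans (ℕP.n<1+n a) 1+a<n
      ¬here : pos x %ℕ n ≢ toℕ (letter a)
      ¬here eq = x≢a (pos-%ℕ-injective x<n a<n (trans eq (toℕ-letter a)))
      ¬next : pos x %ℕ n ≢ suc (toℕ (letter a)) ℕ.% n
      ¬next eq = x≢1+a (pos-%ℕ-injective x<n 1+a<n (trans eq (suc-toℕ-letter a)))

    Realises : (ℕ → ℕ) → List (Fin n) → Set
    Realises π L = All (ParabolicJ n e) L × (∀ c → c ℕ.< n → word n L (pos c) ≡ pos (π c))

    FixesFrom : ℕ → (ℕ → ℕ) → Set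
    FixesFrom m π = ∀ c → m ℕ.≤ c → c ℕ.< n → π c ≡ c

    private
      bounded-everywhere : ∀ {m π} → m ℕ.≤ n → PermutationBelow m π → FixesFrom m π →
                           ∀ c → c ℕ.< n → π c ℕ.< n
      bounded-everywhere {m} m≤n p fixes c c<n with c ℕ.<? m
      ... | yes c<m = ℕP.<-≤-trans (PermutationBelow.bounded p c c<m) m≤n
      ... | no c≮m  = subst (ℕ._< n) (sym (fixes c (ℕP.≮⇒≥ c≮m) c<n)) c<n

      restrict-top : ∀ {m π} → PermutationBelow (suc m) π → π m ≡ m → PermutationBelow m π
      restrict-top {m} {π} p πm≡m = record { bounded = bounded′ ; injective = injective′ }
        where
        open PermutationBelow p
        bounded′ : ∀ c → c ℕ.< m → π c ℕ.< m
        bounded′ c c<m = ℕP.≤∧≢⇒< (ℕP.≤-pred (bounded c (ℕP.m<n⇒m<1+n c<m)))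
          (λ πc≡m → ℕP.<⇒≢ c<m (injective c m (ℕP.m<n⇒m<1+n c<m) ℕP.≤-refl (trans πc≡m (sym πm≡m))))
        injective′ : ∀ c c' → c ℕ.< m → c' ℕ.< m → π c ≡ π c' → c ≡ c'
        injective′ c c' c<m c'<m = injective c c' (ℕP.m<n⇒m<1+n c<m) (ℕP.m<n⇒m<1+n c'<m)

      fixes-top : ∀ {m π} → FixesFrom (suc m) π → π m ≡ m → FixesFrom m π
      fixes-top {m} fixes πm≡m c m≤c c<n with ℕP.m≤n⇒m<n∨m≡n m≤c
      ... | inj₁ m<c  = fixes c m<c c<n
      ... | inj₂ refl = πm≡m

      swap-permutationBelow : ∀ {m π v} → suc v ℕ.≤ m → PermutationBelow (suc m) π →
                              PermutationBelow (suc m) (swap v ∘ π)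
      swap-permutationBelow {v = v} 1+v≤m p = record
        { bounded   = λ c c<1+m → swap-bounded v (bounded c c<1+m) (s≤s 1+v≤m)
        ; injective = λ c c' c<1+m c'<1+m eq → injective c c' c<1+m c'<1+m (swap-injective v eq)
        }
        where open PermutationBelow p

      swap-fixesFrom : ∀ {m π v} → suc v ℕ.≤ m → FixesFrom (suc m) π → FixesFrom (suc m) (swap v ∘ π)
      swap-fixesFrom {m} {π} {v} 1+v≤m fixes c 1+m≤c c<n rewrite fixes c 1+m≤c c<n with swap v c | swap-view v c
      ... | _ | at-a refl     = ⊥-elim (ℕP.<⇒≱ (ℕP.<-trans (ℕP.n<1+n v) (s≤s 1+v≤m)) 1+m≤c)
      ... | _ | at-suc refl   = ⊥-elim (ℕP.<⇒≱ (s≤s 1+v≤m) 1+m≤c)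
      ... | _ | elsewhere _ _ = refl

      prepend : ∀ {π v L} → suc v ℕ.< n → (∀ c → c ℕ.< n → π c ℕ.< n) →
                Realises (swap v ∘ π) L → Realises π (letter v ∷ L)
      prepend {π} {v} {L} 1+v<n π<n (allowed , realises) = letter-allowed v 1+v<n ∷ allowed , λ c c<n → begin
        gen n (letter v) (word n L (pos c))   ≡⟨ cong (gen n (letter v)) (realises c c<n) ⟩
        gen n (letter v) (pos (swap v (π c))) ≡⟨ gen-letter v (swap v (π c)) 1+v<n (swap-bounded v (π<n c c<n) 1+v<n) ⟩
        pos (swap v (swap v (π c)))           ≡⟨ cong pos (swap-involutive v (π c)) ⟩
        pos (π c)                             ∎
        where open ≡-Reasoning

    -- Bubble sort: swap the value at position m upwards until it is m, then recurse below m.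
    realise : ∀ m → m ℕ.≤ n → ∀ π → PermutationBelow m π → FixesFrom m π → ∃ (Realises π)
    realise-top : ∀ m → suc m ℕ.≤ n → ∀ s π → PermutationBelow (suc m) π → FixesFrom (suc m) π →
                  π m ℕ.+ s ≡ m → ∃ (Realises π)

    realise zero    _   π _ fixes = [] , [] , λ c c<n → cong pos (sym (fixes c z≤n c<n))
    realise (suc m) m<n π p fixes =
      realise-top m m<n (m ∸ π m) π p fixes (ℕP.m+[n∸m]≡n (ℕP.≤-pred (PermutationBelow.bounded p m ℕP.≤-refl)))

    realise-top m m<n zero π p fixes πm+0≡m =
      realise m (ℕP.<⇒≤ m<n) π (restrict-top p πm≡m) (fixes-top fixes πm≡m)
      where
      πm≡m = trans (sym (ℕP.+-identityʳ (π m))) πm+0≡m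
    realise-top m m<n (suc s) π p fixes πm+1+s≡m = extend (realise-top m m<n s (swap v ∘ π)
      (swap-permutationBelow 1+v≤m p) (swap-fixesFrom 1+v≤m fixes) (trans (cong (ℕ._+ s) swap-v) moved))
      where
      v = π m
      moved : suc v ℕ.+ s ≡ m
      moved = trans (sym (ℕP.+-suc v s)) πm+1+s≡m
      1+v≤m : suc v ℕ.≤ m
      1+v≤m = ℕP.≤-trans (ℕP.m≤m+n (suc v) s) (ℕP.≤-reflexive moved)
      swap-v : swap v v ≡ suc v
      swap-v = if-yes (v ℕ.≟ v) refl
      extend : ∃ (Realises (swap v ∘ π)) → ∃ (Realises π)
      extend (L , realisesL) = letter v ∷ L , prepend (ℕP.<-≤-trans (s≤s 1+v≤m) m<n) (bounded-everywhere m<n p fixes) realisesL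

    window-permutation⇒parabolic : ∀ f π → Periodic f → PermutationBelow n π →
      (∀ c → c ℕ.< n → f (pos c) ≡ pos (π c)) → InParabolic n (ParabolicJ n e) f
    window-permutation⇒parabolic f π periodic p agree
      with realise n ℕP.≤-refl π p (λ c n≤c c<n → ⊥-elim (ℕP.<⇒≱ c<n n≤c))
    ... | L , allowed , realises = L , allowed , λ m → begin
      f m                            ≡⟨ cong f (decompose m) ⟩
      f (pos (r m) + t m * N)        ≡⟨ periodic-+* f periodic (t m) (pos (r m)) ⟩
      f (pos (r m)) + t m * N        ≡⟨ cong (_+ t m * N) (trans (agree (r m) (r<n m)) (sym (realises (r m) (r<n m)))) ⟩
      word n L (pos (r m)) + t m * N ≡⟨ periodic-+* (word n L) (word-periodic L) (t m) (pos (r m)) ⟨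
      word n L (pos (r m) + t m * N) ≡⟨ cong (word n L) (decompose m) ⟨
      word n L m                     ∎
      where
      open ≡-Reasoning
      r : ℤ → ℕ
      r m = (m - (e + + 1)) %ℕ n
      t : ℤ → ℤ
      t m = (m - (e + + 1)) /ℕ n
      r<n : ∀ m → r m ℕ.< n
      r<n m = n%ℕd<d (m - (e + + 1)) n
      decompose : ∀ m → m ≡ pos (r m) + t m * N
      decompose m = begin
        m                                       ≡⟨ e₁ m (e + + 1) ⟩
        m - (e + + 1) + (e + + 1)               ≡⟨ cong (_+ (e + + 1)) (a≡a%ℕn+[a/ℕn]*n (m - (e + + 1)) n) ⟩
        + r m + t m * N + (e + + 1)             ≡⟨ e₂ (+ r m) (t m) N e ⟩
        e + + 1 + + r m + t m * N               ≡⟨ cong (_+ t m * N) (pos-assoc (r m)) ⟨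
        pos (r m) + t m * N                     ∎
        where
        e₁ : ∀ m b → m ≡ m - b + b
        e₁ = solve-∀
        e₂ : ∀ r t N e → r + t * N + (e + + 1) ≡ e + + 1 + r + t * N
        e₂ = solve-∀

module FactoringSubword (n : ℕ) .{{_ : NonZero n}} (w : ℤ → ℤ) (aff : IsAffPerm n w) (avoids : Avoids3412 w)
  (q : ℤ) (k : ℕ) (factoring : IsFactoringSubword w q k) (j₀ : ℕ) (largest : IsLargestPivotCandidate w q k j₀)
  where

  open Residues n
  open Periodicity n
  open ResidueWindow n using (IsResidueWindow)
  open IsAffPerm aff
  open IsFactoringSubword factoring

  X : ℕ → ℤ
  X = x w q

  j : ℕ
  j = pivot j₀ k

  1≤j₀ : 1 ℕ.≤ j₀
  1≤j₀ = proj₁ largest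

  j₀≤k : j₀ ℕ.≤ k
  j₀≤k = proj₁ (proj₂ largest)

  j₀-candidate : NoneLeftExceeds w q j₀
  j₀-candidate = proj₁ (proj₂ (proj₂ largest))

  j₀-largest : ∀ m → j₀ ℕ.< m → m ℕ.≤ k → ¬ NoneLeftExceeds w q m
  j₀-largest = proj₂ (proj₂ (proj₂ largest))

  pivot-cases : (j ≡ 1 × j₀ ≡ k) ⊎ (j ≡ j₀ × j₀ ℕ.< k)
  pivot-cases with j₀ ℕ.≟ k
  ... | yes j₀≡k = inj₁ (refl , j₀≡k)
  ... | no j₀≢k  = inj₂ (refl , ℕP.≤∧≢⇒< j₀≤k j₀≢k)

  1≤j : 1 ℕ.≤ j
  1≤j with pivot-cases
  ... | inj₁ (j≡1 , _)  = ℕP.≤-reflexive (sym j≡1)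
  ... | inj₂ (j≡j₀ , _) = subst (1 ℕ.≤_) (sym j≡j₀) 1≤j₀

  j≤k : j ℕ.≤ k
  j≤k with pivot-cases
  ... | inj₁ (j≡1 , _)  = subst (ℕ._≤ k) (sym j≡1) k≥1
  ... | inj₂ (j≡j₀ , _) = subst (ℕ._≤ k) (sym j≡j₀) j₀≤k

  X-decreasing : ∀ {a b} → 1 ℕ.≤ a → a ℕ.< b → b ℕ.≤ k → X b < X a
  X-decreasing {a} {suc b} 1≤a (s≤s a≤b) 1+b≤k with ℕP.m≤n⇒m<n∨m≡n a≤b
  ... | inj₁ a<b  = ℤP.<-trans (decr b (ℕP.≤-trans 1≤a a≤b) 1+b≤k) (X-decreasing 1≤a a<b (ℕP.<⇒≤ 1+b≤k))
  ... | inj₂ refl = decr a 1≤a 1+b≤k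

  X-antitone : ∀ {a b} → 1 ℕ.≤ a → a ℕ.≤ b → b ℕ.≤ k → X b ≤ X a
  X-antitone 1≤a a≤b b≤k with ℕP.m≤n⇒m<n∨m≡n a≤b
  ... | inj₁ a<b  = ℤP.<⇒≤ (X-decreasing 1≤a a<b b≤k)
  ... | inj₂ refl = ℤP.≤-refl

  -- x₁ < x_{1+n} by periodicity, so a decreasing run has at most n letters.
  k≤n : k ℕ.≤ n
  k≤n with k ℕ.≤? n
  ... | yes k≤n = k≤n
  ... | no k≰n  = ⊥-elim (ℤP.<-asym (X-decreasing ℕP.≤-refl (s≤s (ℕ.>-nonZero⁻¹ n)) (ℕP.≰⇒> k≰n)) X₁<X₁₊ₙ)
    where
    X₁<X₁₊ₙ : X 1 < X (1 ℕ.+ n)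
    X₁<X₁₊ₙ = subst₂ _<_ (ℤP.+-identityʳ (X 1))
      (trans (sym (periodic (q + + 1))) (cong w (ℤP.+-assoc q (+ 1) N)))
      (ℤP.+-monoʳ-< (X 1) (ℤ.+<+ (ℕ.>-nonZero⁻¹ n)))

  q<q+m : ∀ {m} → 1 ℕ.≤ m → q < q + + m
  q<q+m {m} 1≤m = subst (_< q + + m) (ℤP.+-identityʳ q) (ℤP.+-monoʳ-< q (ℤ.+<+ 1≤m))

  left-below : ∀ {i m} → i ≤ q → 1 ℕ.≤ m → ¬ (w i > X m) → w i < X m
  left-below {i} {m} i≤q 1≤m w≯X = ℤP.≤∧≢⇒< (ℤP.≮⇒≥ w≯X)
    (λ eq → ℤP.<⇒≢ (ℤP.≤-<-trans i≤q (q<q+m 1≤m)) (injective i (q + + m) eq))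

  left<pivot : ∀ {i} → i ≤ q → w i < X j
  left<pivot {i} i≤q with pivot-cases
  ... | inj₁ (j≡1 , _)  = subst (λ m → w i < X m) (sym j≡1) (left i i≤q)
  ... | inj₂ (j≡j₀ , _) = subst (λ m → w i < X m) (sym j≡j₀) (left-below i≤q 1≤j₀ (j₀-candidate i i≤q))

  -- w_i, x₁, x_k, w_{i'} would form a 3412 pattern.
  left<right : ∀ {i i'} → i ≤ q → q + + k < i' → w i < w i'
  left<right {i} {i'} i≤q qk<i' with w i ℤP.<? w i'
  ... | yes lt = lt
  ... | no ¬lt = ⊥-elim (avoids (i , q + + 1 , q + + k , i' ,
                   ℤP.≤-<-trans i≤q (q<q+m ℕP.≤-refl) , q+1<q+k , qk<i' , right i' qk<i' , wi'<wi , left i i≤q))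
    where
    wi'<wi : w i' < w i
    wi'<wi = ℤP.≤∧≢⇒< (ℤP.≮⇒≥ ¬lt)
      (λ eq → ℤP.<⇒≢ (ℤP.≤-<-trans i≤q (ℤP.<-trans (q<q+m k≥1) qk<i')) (sym (injective i' i eq)))
    q+1<q+k : q + + 1 < q + + k
    q+1<q+k with ℕP.m≤n⇒m<n∨m≡n k≥1
    ... | inj₁ 1<k  = ℤP.+-monoʳ-< q (ℤ.+<+ 1<k)
    ... | inj₂ refl = ⊥-elim (ℤP.<-asym (ℤP.<-trans (right i' qk<i') wi'<wi) (left i i≤q))

  tail<right : ∀ {m i'} → j ℕ.< m → m ℕ.≤ k → q + + k < i' → X m < w i'
  tail<right {m} {i'} j<m m≤k qk<i' with pivot-cases
  ... | inj₁ (_ , j₀≡k) = ℤP.≤-<-trans (X-antitone ℕP.≤-refl (ℕP.≤-trans 1≤j (ℕP.<⇒≤ j<m)) m≤k)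
                            (cond4 all-left<xₖ i' qk<i')
    where
    all-left<xₖ : ∀ i → i ≤ q → X k > w i
    all-left<xₖ i i≤q = left-below i≤q k≥1 (subst (λ m → ¬ (w i > X m)) j₀≡k (j₀-candidate i i≤q))
  ... | inj₂ (j≡j₀ , _) with X m ℤP.<? w i'
  ...   | yes lt = lt
  ...   | no ¬lt = ⊥-elim (j₀-largest m (subst (ℕ._< m) j≡j₀ j<m) m≤k none-exceeds)
    where
    none-exceeds : NoneLeftExceeds w q m
    none-exceeds i i≤q wi>Xm = ℤP.<-asym wi>Xm (ℤP.<-≤-trans (left<right i≤q qk<i') (ℤP.≮⇒≥ ¬lt))

  Low High : ℤ → Set
  Low i  = i ≤ q ⊎ ∃ λ m → j ℕ.< m × m ℕ.≤ k × i ≡ q + + m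
  High i = (∃ λ m → 1 ℕ.≤ m × m ℕ.≤ j × i ≡ q + + m) ⊎ q + + k < i

  low<high : ∀ {i i'} → Low i → High i' → w i < w i'
  low<high (inj₁ i≤q) (inj₁ (m , 1≤m , m≤j , refl)) = ℤP.<-≤-trans (left<pivot i≤q) (X-antitone 1≤m m≤j j≤k)
  low<high (inj₁ i≤q) (inj₂ qk<i')                   = left<right i≤q qk<i'
  low<high (inj₂ (m , j<m , m≤k , refl)) (inj₁ (m' , 1≤m' , m'≤j , refl)) =
    X-decreasing 1≤m' (ℕP.≤-<-trans m'≤j j<m) m≤k
  low<high (inj₂ (m , j<m , m≤k , refl)) (inj₂ qk<i') = tail<right j<m m≤k qk<i'

  ψ : ℤ → ℤ
  ψ = Ψ n w q k j

  κ : ℕ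
  κ = k ∸ j

  j+κ≡k : j ℕ.+ κ ≡ k
  j+κ≡k = ℕP.m+[n∸m]≡n j≤k

  -- Definitionally the block formula inside Ψ.
  blockValue : ℕ → ℤ
  blockValue r = if ⌊ r ℕ.<? κ ⌋ then w (q + + (1 ℕ.+ j ℕ.+ r))
                 else if ⌊ r ℕ.<? k ⌋ then w (q + + (1 ℕ.+ r ∸ κ))
                 else w (q + + (1 ℕ.+ r))

  blockValue-front : ∀ {r} → r ℕ.< κ → blockValue r ≡ w (q + + (1 ℕ.+ j ℕ.+ r))
  blockValue-front {r} r<κ = if-yes (r ℕ.<? κ) r<κ

  blockValue-back : ∀ {r} → ¬ r ℕ.< κ → r ℕ.< k → blockValue r ≡ w (q + + (1 ℕ.+ r ∸ κ))
  blockValue-back {r} r≮κ r<k = trans (if-no (r ℕ.<? κ) r≮κ) (if-yes (r ℕ.<? k) r<k)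

  blockValue-rest : ∀ {r} → ¬ r ℕ.< κ → ¬ r ℕ.< k → blockValue r ≡ w (q + + (1 ℕ.+ r))
  blockValue-rest {r} r≮κ r≮k = trans (if-no (r ℕ.<? κ) r≮κ) (if-no (r ℕ.<? k) r≮k)

  ψ-eval : ∀ i r t → r ℕ.< n → i - (q + + 1) ≡ + r + t * N → ψ i ≡ blockValue r + t * N
  ψ-eval i r t r<n eq with %ℕ-/ℕ-unique t r<n eq
  ... | r≡ , t≡ = cong₂ (λ a b → blockValue a + b * N) r≡ t≡

  ψ-periodic : Periodic ψ
  ψ-periodic i = begin
    ψ (i + N)                ≡⟨ ψ-eval (i + N) r (t + + 1) r<n (trans (e₁ i N (q + + 1)) (trans (cong (_+ N) decomposition) (e₂ (+ r) t N))) ⟩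
    blockValue r + (t + + 1) * N  ≡⟨ e₃ (blockValue r) t N ⟩
    blockValue r + t * N + N ≡⟨ cong (_+ N) (ψ-eval i r t r<n decomposition) ⟨
    ψ i + N                  ∎
    where
    open ≡-Reasoning
    r = (i - (q + + 1)) %ℕ n
    t = (i - (q + + 1)) /ℕ n
    r<n = n%ℕd<d (i - (q + + 1)) n
    decomposition = a≡a%ℕn+[a/ℕn]*n (i - (q + + 1)) n
    e₁ : ∀ i N b → i + N - b ≡ i - b + N
    e₁ = solve-∀
    e₂ : ∀ r t N → r + t * N + N ≡ r + (t + + 1) * N
    e₂ = solve-∀
    e₃ : ∀ b t N → b + (t + + 1) * N ≡ b + t * N + N
    e₃ = solve-∀

  d : ℤ
  d = q + + k - + j

  open Generators n using (module Window)
  open Window d using (pos; pos-assoc)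

  pos-offset : ∀ c → pos c - (q + + 1) ≡ + (κ ℕ.+ c)
  pos-offset c = trans (cong (λ K → q + K - + j + + suc c - (q + + 1)) (cong +_ (sym j+κ≡k))) (e q (+ j) (+ κ) (+ c))
    where
    e : ∀ q j κ c → q + (j + κ) - j + (+ 1 + c) - (q + + 1) ≡ κ + c
    e = solve-∀

  -- ψ (pos c) = w (q + 1 + s) up to a period, where s is a shuffle of c; unshuffle inverts the shuffle.
  unshuffle : ℕ → ℕ
  unshuffle s = if ⌊ s ℕ.<? j ⌋ then s else if ⌊ s ℕ.<? k ⌋ then s ℕ.+ n ∸ k else s ℕ.+ j ∸ k

  record Source (c : ℕ) : Set where
    field
      offset    : ℕ
      shift     : ℤ
      offset<n  : offset ℕ.< n
      position  : ℤ
      position≡ : position ≡ q + + suc offset + shift * N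
      value     : ψ (pos c) ≡ w position
      high      : High position
      low       : Low (position - N)
      recover   : unshuffle offset ≡ c

  private
    q+m-N≤q : ∀ {m} → m ℕ.≤ n → q + + m - N ≤ q
    q+m-N≤q {m} m≤n = subst₂ _≤_ (e q (+ m) N) (ℤP.+-identityʳ q) (ℤP.+-monoʳ-≤ q (ℤP.i≤j⇒i-j≤0 (ℤ.+≤+ m≤n)))
      where
      e : ∀ q m N → q + (m - N) ≡ q + m - N
      e = solve-∀

    q+m+0*N : ∀ m → q + + m ≡ q + + m + 0ℤ * N
    q+m+0*N m = sym (ℤP.+-identityʳ (q + + m))

    κ+<k : ∀ {c} → c ℕ.< j → κ ℕ.+ c ℕ.< k
    κ+<k {c} c<j = subst (κ ℕ.+ c ℕ.<_) (trans (ℕP.+-comm κ j) j+κ≡k) (ℕP.+-monoʳ-< κ c<j)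

    back-index : ∀ c → suc (κ ℕ.+ c) ∸ κ ≡ suc c
    back-index c = trans (cong (_∸ κ) (sym (ℕP.+-suc κ c))) (ℕP.m+n∸m≡n κ (suc c))

    ψ-at-block : ∀ c → κ ℕ.+ c ℕ.< n → ψ (pos c) ≡ blockValue (κ ℕ.+ c)
    ψ-at-block c ρ<n = trans (ψ-eval (pos c) (κ ℕ.+ c) 0ℤ ρ<n (trans (pos-offset c) (sym (ℤP.+-identityʳ _))))
                             (ℤP.+-identityʳ _)

    source-front : ∀ c → c ℕ.< n → c ℕ.< j → Source c
    source-front c c<n c<j = record
      { offset = c ; shift = 0ℤ ; offset<n = c<n
      ; position = q + + suc c ; position≡ = q+m+0*N (suc c)
      ; value    = trans (ψ-at-block c ρ<n) (trans (blockValue-back (ℕP.m+n≮m κ c) ρ<k) (cong (λ m → w (q + + m)) (back-index c)))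
      ; high     = inj₁ (suc c , s≤s z≤n , c<j , refl)
      ; low      = inj₁ (q+m-N≤q c<n)
      ; recover  = if-yes (c ℕ.<? j) c<j
      }
      where
      ρ<k = κ+<k c<j
      ρ<n = ℕP.<-≤-trans ρ<k k≤n

    source-middle : ∀ c → j ℕ.≤ c → κ ℕ.+ c ℕ.< n → Source c
    source-middle c j≤c ρ<n = record
      { offset = ρ ; shift = 0ℤ ; offset<n = ρ<n
      ; position = q + + suc ρ ; position≡ = q+m+0*N (suc ρ)
      ; value    = trans (ψ-at-block c ρ<n) (blockValue-rest (ℕP.m+n≮m κ c) ρ≮k)
      ; high     = inj₂ (ℤP.+-monoʳ-< q (ℤ.+<+ (s≤s k≤ρ)))
      ; low      = inj₁ (q+m-N≤q ρ<n)
      ; recover  = trans (trans (if-no (ρ ℕ.<? j) ρ≮j) (if-no (ρ ℕ.<? k) ρ≮k)) index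
      }
      where
      ρ = κ ℕ.+ c
      k≤ρ : k ℕ.≤ ρ
      k≤ρ = subst (ℕ._≤ ρ) (trans (ℕP.+-comm κ j) j+κ≡k) (ℕP.+-monoʳ-≤ κ j≤c)
      ρ≮k : ¬ ρ ℕ.< k
      ρ≮k = ℕP.≤⇒≯ k≤ρ
      ρ≮j : ¬ ρ ℕ.< j
      ρ≮j ρ<j = ρ≮k (ℕP.<-≤-trans ρ<j j≤k)
      index : ρ ℕ.+ j ∸ k ≡ c
      index = trans (cong (_∸ k) (trans (ℕP.+-comm ρ j) (trans (sym (ℕP.+-assoc j κ c)) (cong (ℕ._+ c) j+κ≡k))))
                    (ℕP.m+n∸m≡n k c)

    source-wrapped : ∀ c → c ℕ.< n → n ℕ.≤ κ ℕ.+ c → Source c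
    source-wrapped c c<n n≤ρ = record
      { offset = s ; shift = + 1 ; offset<n = ℕP.<-≤-trans s<k k≤n
      ; position = q + + suc s + N ; position≡ = cong (_+_ (q + + suc s)) (sym (ℤP.*-identityˡ N))
      ; value    = begin
          ψ (pos c)                  ≡⟨ ψ-eval (pos c) r (+ 1) r<n offset-eq ⟩
          blockValue r + + 1 * N     ≡⟨ cong₂ _+_ (blockValue-front r<κ) (ℤP.*-identityˡ N) ⟩
          w (q + + suc s) + N        ≡⟨ periodic (q + + suc s) ⟨
          w (q + + suc s + N)        ∎
      ; high     = inj₂ (subst (q + + k <_) (sym (ℤP.+-assoc q (+ suc s) N))
                      (ℤP.+-monoʳ-< q (ℤ.+<+ (s≤s (ℕP.≤-trans k≤n (ℕP.m≤n+m n s))))))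
      ; low      = inj₂ (suc s , s≤s (ℕP.m≤m+n j r) , s<k , e q (+ suc s) N)
      ; recover  = trans (trans (if-no (s ℕ.<? j) (ℕP.m+n≮m j r)) (if-yes (s ℕ.<? k) s<k)) index
      }
      where
      open ≡-Reasoning
      ρ = κ ℕ.+ c
      r = ρ ∸ n
      s = j ℕ.+ r
      r+n≡ρ : r ℕ.+ n ≡ ρ
      r+n≡ρ = ℕP.m∸n+n≡m n≤ρ
      r<κ : r ℕ.< κ
      r<κ = ℕP.+-cancelʳ-< n r κ (subst (ℕ._< κ ℕ.+ n) (sym r+n≡ρ) (ℕP.+-monoʳ-< κ c<n))
      r<n : r ℕ.< n
      r<n = ℕP.<-≤-trans r<κ (ℕP.≤-trans (ℕP.m∸n≤m k j) k≤n)
      s<k : s ℕ.< k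
      s<k = subst (s ℕ.<_) j+κ≡k (ℕP.+-monoʳ-< j r<κ)
      offset-eq : pos c - (q + + 1) ≡ + r + + 1 * N
      offset-eq = trans (pos-offset c) (trans (cong +_ (sym r+n≡ρ)) (cong (_+_ (+ r)) (sym (ℤP.*-identityˡ N))))
      e : ∀ q a N → q + a + N - N ≡ q + a
      e = solve-∀
      index : s ℕ.+ n ∸ k ≡ c
      index = trans (cong (_∸ k) (trans (ℕP.+-assoc j r n) (trans (cong (j ℕ.+_) r+n≡ρ)
                    (trans (sym (ℕP.+-assoc j κ c)) (cong (ℕ._+ c) j+κ≡k))))) (ℕP.m+n∸m≡n k c)

  source : ∀ c → c ℕ.< n → Source c
  source c c<n with c ℕ.<? j
  ... | yes c<j = source-front c c<n c<j
  ... | no c≮j with κ ℕ.+ c ℕ.<? n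
  ...   | yes ρ<n = source-middle c (ℕP.≮⇒≥ c≮j) ρ<n
  ...   | no ρ≮n  = source-wrapped c c<n (ℕP.≮⇒≥ ρ≮n)

  ψ-spread : ∀ c c' → c ℕ.< n → c' ℕ.< n → ψ (pos c) < ψ (pos c') + N
  ψ-spread c c' c<n c'<n = begin-strict
    ψ (pos c)                      ≡⟨ e (ψ (pos c)) N ⟩
    ψ (pos c) - N + N              ≡⟨ cong (λ v → v - N + N) (value S) ⟩
    w (position S) - N + N         ≡⟨ cong (_+ N) (periodic-backward w periodic (position S)) ⟨
    w (position S - N) + N         <⟨ ℤP.+-monoˡ-< N (low<high (low S) (high S')) ⟩
    w (position S') + N            ≡⟨ cong (_+ N) (value S') ⟨
    ψ (pos c') + N                 ∎
    where
    open ℤP.≤-Reasoning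
    open Source
    S  = source c c<n
    S' = source c' c'<n
    e : ∀ x N → x ≡ x - N + N
    e = solve-∀

  ψ-distinct : ∀ c c' t → c ℕ.< n → c' ℕ.< n → ψ (pos c) ≡ ψ (pos c') + t * N → c ≡ c'
  ψ-distinct c c' t c<n c'<n eq = begin
    c                      ≡⟨ recover S ⟨
    unshuffle (offset S)   ≡⟨ cong unshuffle offsets ⟩
    unshuffle (offset S')  ≡⟨ recover S' ⟩
    c'                     ∎
    where
    open ≡-Reasoning
    open Source
    S  = source c c<n
    S' = source c' c'<n
    positions : position S ≡ position S' + t * N
    positions = injective _ _ (trans (sym (value S)) (trans eq
                  (trans (cong (_+ t * N) (value S')) (sym (periodic-+* w periodic t (position S'))))))
    strip : ∀ q s s' u u' t N → q + (+ 1 + s) + u * N ≡ q + (+ 1 + s') + u' * N + t * N →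
            s + u * N ≡ s' + (u' + t) * N
    strip q s s' u u' t N eq = trans (e₁ q s u N) (trans (cong (λ v → v - q - + 1) eq) (e₂ q s' u' t N))
      where
      e₁ : ∀ q s u N → s + u * N ≡ q + (+ 1 + s) + u * N - q - + 1
      e₁ = solve-∀
      e₂ : ∀ q s' u' t N → q + (+ 1 + s') + u' * N + t * N - q - + 1 ≡ s' + (u' + t) * N
      e₂ = solve-∀
    offsets : offset S ≡ offset S'
    offsets = proj₁ (divMod-unique (shift S) (shift S' + t) (offset<n S) (offset<n S')
                (strip q (+ offset S) (+ offset S') (shift S) (shift S') t N
                  (trans (sym (position≡ S)) (trans positions (cong (_+ t * N) (position≡ S'))))))

  private
    W : ℕ → ℤ
    W r = w (q + + suc r)

    windowSum≡∑W : windowSum w (q + + 1) ≡ ∑ n W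
    windowSum≡∑W = ∑-cong n (λ c _ → cong w (ℤP.+-assoc q (+ 1) (+ c)))

    κ+j≡k : κ ℕ.+ j ≡ k
    κ+j≡k = trans (ℕP.+-comm κ j) j+κ≡k

    k+[n∸k]≡n : k ℕ.+ (n ∸ k) ≡ n
    k+[n∸k]≡n = ℕP.m+[n∸m]≡n k≤n

  blockValue-sum : ∑ n blockValue ≡ ∑ κ (W ∘ (j ℕ.+_)) + (∑ j W + ∑ (n ∸ k) (W ∘ (k ℕ.+_)))
  blockValue-sum = begin
    ∑ n blockValue                                                 ≡⟨ cong (λ l → ∑ l blockValue) n≡ ⟩
    ∑ (κ ℕ.+ (j ℕ.+ (n ∸ k))) blockValue                           ≡⟨ ∑-split κ _ blockValue ⟩
    ∑ κ blockValue + ∑ (j ℕ.+ (n ∸ k)) (blockValue ∘ (κ ℕ.+_))     ≡⟨ cong (_+_ (∑ κ blockValue)) (∑-split j (n ∸ k) _) ⟩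
    ∑ κ blockValue + (∑ j (blockValue ∘ (κ ℕ.+_)) + ∑ (n ∸ k) (blockValue ∘ (κ ℕ.+_) ∘ (j ℕ.+_)))
                                                                   ≡⟨ cong₂ _+_ front (cong₂ _+_ back rest) ⟩
    ∑ κ (W ∘ (j ℕ.+_)) + (∑ j W + ∑ (n ∸ k) (W ∘ (k ℕ.+_)))        ∎
    where
    open ≡-Reasoning
    n≡ : n ≡ κ ℕ.+ (j ℕ.+ (n ∸ k))
    n≡ = sym (trans (sym (ℕP.+-assoc κ j (n ∸ k))) (trans (cong (ℕ._+ (n ∸ k)) κ+j≡k) k+[n∸k]≡n))
    κ+[j+r]≡k+r : ∀ r → κ ℕ.+ (j ℕ.+ r) ≡ k ℕ.+ r
    κ+[j+r]≡k+r r = trans (sym (ℕP.+-assoc κ j r)) (cong (ℕ._+ r) κ+j≡k)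
    front : ∑ κ blockValue ≡ ∑ κ (W ∘ (j ℕ.+_))
    front = ∑-cong κ (λ r r<κ → blockValue-front r<κ)
    back : ∑ j (blockValue ∘ (κ ℕ.+_)) ≡ ∑ j W
    back = ∑-cong j (λ r r<j → trans (blockValue-back (ℕP.m+n≮m κ r) (κ+<k r<j)) (cong (λ m → w (q + + m)) (back-index r)))
    rest : ∑ (n ∸ k) (blockValue ∘ (κ ℕ.+_) ∘ (j ℕ.+_)) ≡ ∑ (n ∸ k) (W ∘ (k ℕ.+_))
    rest = ∑-cong (n ∸ k) (λ r _ → trans
      (blockValue-rest (ℕP.m+n≮m κ (j ℕ.+ r)) (ℕP.≤⇒≯ (subst (k ℕ.≤_) (sym (κ+[j+r]≡k+r r)) (ℕP.m≤m+n k r))))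
      (cong W (κ+[j+r]≡k+r r)))

  W-sum : ∑ n W ≡ ∑ j W + (∑ κ (W ∘ (j ℕ.+_)) + ∑ (n ∸ k) (W ∘ (k ℕ.+_)))
  W-sum = begin
    ∑ n W                                                          ≡⟨ cong (λ l → ∑ l W) n≡ ⟩
    ∑ (j ℕ.+ (κ ℕ.+ (n ∸ k))) W                                    ≡⟨ ∑-split j _ W ⟩
    ∑ j W + ∑ (κ ℕ.+ (n ∸ k)) (W ∘ (j ℕ.+_))                       ≡⟨ cong (_+_ (∑ j W)) (∑-split κ (n ∸ k) _) ⟩
    ∑ j W + (∑ κ (W ∘ (j ℕ.+_)) + ∑ (n ∸ k) (W ∘ (j ℕ.+_) ∘ (κ ℕ.+_)))
                                                                   ≡⟨ cong (λ v → ∑ j W + (∑ κ (W ∘ (j ℕ.+_)) + v)) rest ⟩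
    ∑ j W + (∑ κ (W ∘ (j ℕ.+_)) + ∑ (n ∸ k) (W ∘ (k ℕ.+_)))        ∎
    where
    open ≡-Reasoning
    n≡ : n ≡ j ℕ.+ (κ ℕ.+ (n ∸ k))
    n≡ = sym (trans (sym (ℕP.+-assoc j κ (n ∸ k))) (trans (cong (ℕ._+ (n ∸ k)) j+κ≡k) k+[n∸k]≡n))
    rest : ∑ (n ∸ k) (W ∘ (j ℕ.+_) ∘ (κ ℕ.+_)) ≡ ∑ (n ∸ k) (W ∘ (k ℕ.+_))
    rest = ∑-cong (n ∸ k) (λ r _ → cong W (trans (sym (ℕP.+-assoc j κ r)) (cong (ℕ._+ r) j+κ≡k)))

  -- ψ only permutes the values in positions q + 1, …, q + n.
  windowSum-ψ : windowSum ψ (q + + 1) ≡ windowSum w (q + + 1)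
  windowSum-ψ = begin
    windowSum ψ (q + + 1)     ≡⟨ ∑-cong n (λ c c<n → trans (ψ-eval (q + + 1 + + c) c 0ℤ c<n (e q (+ c))) (ℤP.+-identityʳ _)) ⟩
    ∑ n blockValue            ≡⟨ blockValue-sum ⟩
    _                         ≡⟨ swap-first (∑ κ (W ∘ (j ℕ.+_))) (∑ j W) _ ⟩
    _                         ≡⟨ W-sum ⟨
    ∑ n W                     ≡⟨ windowSum≡∑W ⟨
    windowSum w (q + + 1)     ∎
    where
    open ≡-Reasoning
    e : ∀ q c → q + + 1 + c - (q + + 1) ≡ c + 0ℤ * N
    e = solve-∀
    swap-first : ∀ a b c → a + (b + c) ≡ b + (a + c)
    swap-first = solve-∀

  windowExcess-w : windowExcess w (+ 1) ≡ 0ℤ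
  windowExcess-w = trans (cong₂ _-_ w-sum (∑-suc≡binomial n)) (ℤP.+-inverseʳ (+ (suc n C 2)))
    where
    w-sum : windowSum w (+ 1) ≡ + (suc n C 2)
    w-sum = trans (sym (sumℤ-applyUpTo n (λ c → c) (λ i → w (+ suc i)))) window-sum

  windowExcess-ψ : windowExcess ψ (d + + 1) ≡ 0ℤ
  windowExcess-ψ = begin
    windowExcess ψ (d + + 1)  ≡⟨ windowExcess-invariant ψ ψ-periodic (d + + 1) (q + + 1) ⟩
    windowExcess ψ (q + + 1)  ≡⟨ cong (_- windowSum (λ i → i) (q + + 1)) windowSum-ψ ⟩
    windowExcess w (q + + 1)  ≡⟨ windowExcess-invariant w periodic (q + + 1) (+ 1) ⟩
    windowExcess w (+ 1)      ≡⟨ windowExcess-w ⟩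
    0ℤ                        ∎
    where open ≡-Reasoning

  z : ℕ → ℤ
  z c = ψ (pos c) - (d + + 1)

  z-isResidueWindow : IsResidueWindow z
  z-isResidueWindow = record
    { spread   = λ c c' c<n c'<n → subst (z c <_) (e₁ (ψ (pos c')) N (d + + 1))
                                     (ℤP.+-monoˡ-< (- (d + + 1)) (ψ-spread c c' c<n c'<n))
    ; distinct = λ c c' t c<n c'<n eq → ψ-distinct c c' t c<n c'<n
                   (trans (e₂ (ψ (pos c)) (d + + 1)) (trans (cong (_+ (d + + 1)) eq) (e₃ (ψ (pos c')) (d + + 1) t N)))
    ; total    = total
    }
    where
    e₁ : ∀ x N D → x + N - D ≡ x - D + N
    e₁ = solve-∀
    e₂ : ∀ x D → x ≡ x - D + D
    e₂ = solve-∀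
    e₃ : ∀ x D t N → x - D + t * N + D ≡ x + t * N
    e₃ = solve-∀
    D = d + + 1
    total : ∑ n z ≡ ∑ n (+_)
    total = begin
      ∑ n z                                  ≡⟨ ∑-+ n (ψ ∘ pos) (λ _ → - D) ⟩
      ∑ n (ψ ∘ pos) + ∑ n (λ _ → - D)        ≡⟨ cong₂ _+_ (∑-cong n (λ c _ → cong ψ (pos-assoc c))) (∑-const n (- D)) ⟩
      windowSum ψ D + + n * - D              ≡⟨ cong (_+ + n * - D) (ℤP.i-j≡0⇒i≡j (windowSum ψ D) (windowSum (λ i → i) D) windowExcess-ψ) ⟩
      windowSum (λ i → i) D + + n * - D      ≡⟨ cong (_+ + n * - D) (∑-cong n (λ c _ → ℤP.+-comm D (+ c))) ⟩
      ∑ n (λ c → + c + D) + + n * - D        ≡⟨ cong (_+ + n * - D) (trans (∑-+ n (+_) (λ _ → D)) (cong (_+_ (∑ n (+_))) (∑-const n D))) ⟩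
      ∑ n (+_) + + n * D + + n * - D         ≡⟨ e (∑ n (+_)) (+ n) D ⟩
      ∑ n (+_)                               ∎
      where
      open ≡-Reasoning
      e : ∀ s m D → s + m * D + m * - D ≡ s
      e = solve-∀

lemma3p8 : (n : ℕ) → .{{_ : NonZero n}} → 2 ℕ.≤ n →
    (w : ℤ → ℤ) → IsAffPerm n w → Avoids3412 w →
    (q : ℤ) (k : ℕ) → IsFactoringSubword w q k →
    (j₀ : ℕ) → IsLargestPivotCandidate w q k j₀ →
    InParabolic n (ParabolicJ n ((q + + k) - + (pivot j₀ k))) (Ψ n w q k (pivot j₀ k))
lemma3p8 n _ w aff avoids q k factoring j₀ largest =
  window-permutation⇒parabolic ψ (ℤ.∣_∣ ∘ z) ψ-periodic (∣∣-permutationBelow z-isResidueWindow) ψ-on-window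
  where
  open FactoringSubword n w aff avoids q k factoring j₀ largest
  open ResidueWindow n
  open Generators.Window n d
  ψ-on-window : ∀ c → c ℕ.< n → ψ (pos c) ≡ pos ℤ.∣ z c ∣
  ψ-on-window c c<n = begin
    ψ (pos c)               ≡⟨ e (ψ (pos c)) (d + + 1) ⟩
    d + + 1 + z c           ≡⟨ cong (_+_ (d + + 1)) (+∣∣≡ z-isResidueWindow c c<n) ⟨
    d + + 1 + + ℤ.∣ z c ∣   ≡⟨ pos-assoc ℤ.∣ z c ∣ ⟨
    pos ℤ.∣ z c ∣           ∎
    where
    open ≡-Reasoning
    e : ∀ x D → x ≡ D + (x - D)
    e = solve-∀
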